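{- Let $G$ be an instance with unique lower and upper limit trees satisfying $T_L=T_U$. Then $G$ is prediction mandatory free if and only if $\hat w_{f_i}\ge U_e$ and $\hat w_e\le L_{f_i}$ hold for each $e\in C_i\setminus\{f_i\}$ and each cycle $C_i$ with $i\in\{1,\dots,l\}$. Moreover, once an instance is prediction mandatory free, it remains so even if further edges are queried, as long as unique lower and upper limit trees with $T_L=T_U$ are maintained; that is, if $G$ is prediction mandatory free with unique $T_L=T_U$ and $G'$ is obtained from $G$ by querying a set of edges and has unique $T_L'=T_U'$, then $G'$ is prediction mandatory free.
   Context: An instance is a connected (multi)graph $G=(V,E)$; each edge $e$ has unknown true weight $w_e\in\mathbb{R}_+$ and known uncertainty interval $I_e$, either open $(L_e,U_e)\ni w_e$ or trivial $\{w_e\}$ (then $L_e=U_e=w_e$); predictions $\hat w_e\in I_e$ are given. Querying $e$ reveals $w_e$. $Q\subseteq E$ is a feasible query set if some spanning tree is a minimum spanning tree for every weight assignment equal to $w_e$ on $Q$ and arbitrary in $I_e$ outside $Q$. An edge is prediction mandatory if it belongs to every feasible query set under the hypothesis that all true values equal the predictions; an instance is prediction mandatory free if it has no prediction mandatory edge. A lower limit tree $T_L$ is an MST for weights $L_e+\epsilon$, an upper limit tree $T_U$ an MST for weights $U_e-\epsilon$ ($\epsilon>0$ infinitesimal). Let $f_1,\dots,f_l$ be the non-trivial edges of $E\setminus T_L$ (trivial edges outside $T_L$ are maximal on a cycle and may be deleted) ordered by non-decreasing lower limit, and $C_i$ the unique cycle in $T_L\cup\{f_i\}$.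
   Formalization: The true weights, the limits $L_e$ and $U_e$, the predictions $\hat w_e$ and the arbitrary weights in the definition of a feasible query set are rational instead of real. -}

module Defs where

open import Data.Nat using (ℕ; zero; suc)
open import Data.Fin using (Fin; zero; suc; _≟_)
open import Data.Bool using (Bool; true; false; if_then_else_; _∨_)
open import Data.List using (List; []; _∷_)
open import Data.List.Membership.Propositional using (_∈_)
open import Data.List.Relation.Unary.Unique.Propositional using (Unique)
open import Data.Product using (Σ; ∃; _×_; _,_)
open import Data.Sum using (_⊎_)
open import Data.Integer as ℤ using (ℤ; +_; -[1+_])
open import Data.Rational as ℚ using (ℚ; 0ℚ)
open import Relation.Nullary using (¬_; Dec; yes; no)
open import Relation.Binary.PropositionalEquality using (_≡_)
open import Function using (_∘_; _⇔_)

record Graph : Set where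
  field
    n   : ℕ
    m   : ℕ
    src : Fin m → Fin n
    tgt : Fin m → Fin n
open Graph public

EdgeSet : Graph → Set
EdgeSet g = Fin (m g) → Bool

remove : (g : Graph) → EdgeSet g → Fin (m g) → EdgeSet g
remove g S e e' with e' ≟ e
... | yes _ = false
... | no _  = S e'

Step : (g : Graph) → Fin (m g) → Fin (n g) → Fin (n g) → Set
Step g e u x = (src g e ≡ u × tgt g e ≡ x) ⊎ (tgt g e ≡ u × src g e ≡ x)

data Walk (g : Graph) (S : EdgeSet g) :
     Fin (n g) → Fin (n g) → List (Fin (m g)) → List (Fin (n g)) → Set where
  done : ∀ {v} → Walk g S v v [] (v ∷ [])
  step : ∀ {e u x v es vs} → S e ≡ true → Step g e u x →
         Walk g S x v es vs → Walk g S u v (e ∷ es) (u ∷ vs)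

Connected : (g : Graph) → EdgeSet g → Fin (n g) → Fin (n g) → Set
Connected g S u v = ∃ λ es → ∃ λ vs → Walk g S u v es vs

Path : (g : Graph) → EdgeSet g → Fin (n g) → Fin (n g) → List (Fin (m g)) → Set
Path g S u v es = ∃ λ vs → Walk g S u v es vs × Unique vs

GraphConnected : Graph → Set
GraphConnected g = ∀ u v → Connected g (λ _ → true) u v

Acyclic : (g : Graph) → EdgeSet g → Set
Acyclic g S = ¬ (Σ (Fin (m g)) λ e → S e ≡ true × Connected g (remove g S e) (src g e) (tgt g e))

SpanningTree : (g : Graph) → EdgeSet g → Set
SpanningTree g S = (∀ u v → Connected g S u v) × Acyclic g S

sumℚ : ∀ {k} → (Fin k → Bool) → (Fin k → ℚ) → ℚ
sumℚ {zero}  S w = 0ℚ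
sumℚ {suc k} S w = (if S zero then w zero else 0ℚ) ℚ.+ sumℚ (S ∘ suc) (w ∘ suc)

sumℤ : ∀ {k} → (Fin k → Bool) → (Fin k → ℤ) → ℤ
sumℤ {zero}  S t = + 0
sumℤ {suc k} S t = (if S zero then t zero else + 0) ℤ.+ sumℤ (S ∘ suc) (t ∘ suc)

MST : (g : Graph) → (Fin (m g) → ℚ) → EdgeSet g → Set
MST g w T = SpanningTree g T ×
  (∀ T' → SpanningTree g T' → sumℚ T w ℚ.≤ sumℚ T' w)

-- T is an MST for weights w e + t e · ε, ε > 0 infinitesimal
-- (lexicographic comparison of (real part, ε-coefficient)).
MSTε : (g : Graph) → (Fin (m g) → ℚ) → (Fin (m g) → ℤ) → EdgeSet g → Set
MSTε g w t T = SpanningTree g T ×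
  (∀ T' → SpanningTree g T' →
     (sumℚ T w ℚ.< sumℚ T' w) ⊎ (sumℚ T w ≡ sumℚ T' w × sumℤ T t ℤ.≤ sumℤ T' t))

UniqueMSTε : (g : Graph) → (Fin (m g) → ℚ) → (Fin (m g) → ℤ) → EdgeSet g → Set
UniqueMSTε g w t T = MSTε g w t T × (∀ T' → MSTε g w t T' → ∀ e → T' e ≡ T e)

-- Uncertainty data: for each edge a trivial flag, limits L, U and a
-- prediction ŵ.  Open interval (L e, U e) if not trivial, {L e} if trivial.

record Uncertainty (g : Graph) : Set where
  field
    trivial : Fin (m g) → Bool
    L       : Fin (m g) → ℚ
    U       : Fin (m g) → ℚ
    ŵ       : Fin (m g) → ℚ
open Uncertainty public

InI : {g : Graph} → Uncertainty g → Fin (m g) → ℚ → Set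
InI I e x = if trivial I e then x ≡ L I e else (L I e ℚ.< x × x ℚ.< U I e)

Valid : (g : Graph) → (Fin (m g) → ℚ) → Uncertainty g → Set
Valid g w I = ∀ e → (0ℚ ℚ.≤ w e) × InI I e (w e) × InI I e (ŵ I e)
                    × (trivial I e ≡ true → U I e ≡ L I e)

-- lower limit tree weights L_e + ε (open) / w_e (trivial)
lowerEps : {g : Graph} → Uncertainty g → Fin (m g) → ℤ
lowerEps I e = if trivial I e then + 0 else + 1

-- upper limit tree weights U_e − ε (open) / w_e (trivial)
upperEps : {g : Graph} → Uncertainty g → Fin (m g) → ℤ
upperEps I e = if trivial I e then + 0 else -[1+ 0 ]

UniqueLowerLimitTree : (g : Graph) → Uncertainty g → EdgeSet g → Set
UniqueLowerLimitTree g I T = UniqueMSTε g (L I) (lowerEps I) T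

UniqueUpperLimitTree : (g : Graph) → Uncertainty g → EdgeSet g → Set
UniqueUpperLimitTree g I T = UniqueMSTε g (U I) (upperEps I) T

Feasible : (g : Graph) → Uncertainty g → (Fin (m g) → ℚ) → EdgeSet g → Set
Feasible g I w Q = Σ (EdgeSet g) λ T →
  ∀ (w' : Fin (m g) → ℚ) →
    (∀ e → Q e ≡ true → w' e ≡ w e) →
    (∀ e → Q e ≡ false → InI I e (w' e)) →
    MST g w' T

PredictionMandatory : (g : Graph) → Uncertainty g → Fin (m g) → Set
PredictionMandatory g I e = ∀ Q → Feasible g I (ŵ I) Q → Q e ≡ true

PredictionMandatoryFree : (g : Graph) → Uncertainty g → Set
PredictionMandatoryFree g I = ∀ e → ¬ PredictionMandatory g I e

-- For a non-trivial edge f ∉ T_L, the cycle C_f in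
-- T_L ∪ {f} consists of f and the edges of the T_L-path between the
-- endpoints of f; e ∈ C_f ∖ {f} iff e lies on that path.

InCycleMinus : (g : Graph) → EdgeSet g → Fin (m g) → Fin (m g) → Set
InCycleMinus g TL f e = ∃ λ es → Path g TL (src g f) (tgt g f) es × e ∈ es

CycleCondition : (g : Graph) → Uncertainty g → EdgeSet g → Set
CycleCondition g I TL = ∀ f → trivial I f ≡ false → TL f ≡ false →
  ∀ e → InCycleMinus g TL f e → (U I e ℚ.≤ ŵ I f) × (ŵ I e ℚ.≤ L I f)

query : (g : Graph) → (Fin (m g) → ℚ) → EdgeSet g → Uncertainty g → Uncertainty g
query g w Q I = record
  { trivial = λ e → Q e ∨ trivial I e
  ; L = λ e → if Q e then w e else L I e
  ; U = λ e → if Q e then w e else U I e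
  ; ŵ = λ e → if Q e then w e else ŵ I e
  }

{-# OPTIONS --safe #-}

-- The argument runs through the exchange property of spanning trees: if x lies on the cycle
-- that an edge y closes in a spanning tree T, then T - x + y is again a spanning tree. Hence a
-- tree is minimum exactly when w x ≤ w y along all such pairs, and a unique lower (upper) limit
-- tree orders the lower (upper) limits along them, strictly at open edges.
--
-- Under the cycle condition T stays minimum however a single unqueried edge is weighted, so no
-- edge is prediction mandatory. Conversely, a violation ŵ f < U x makes the edge of largest
-- upper limit on the cycle of f prediction mandatory, and a violation L f < ŵ x does so for the
-- violating f of smallest lower limit: a value near the bottom of its interval forces such an
-- edge into every minimum spanning tree, a value near the top forces it out. After querying,
-- every pair of the new limit tree T' is related to pairs of T by exchanges between T and T',
-- so the cycle condition for T' is inherited from the one for T.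
--
-- Connectivity is used classically: the arguments run in the double-negation monad and leave it
-- through decidable conclusions.
module Submission where

open import Defs
open import Algebra.Bundles using (CommutativeMonoid)
import Algebra.Properties.CommutativeSemigroup as CommutativeSemigroupProperties
open import Data.Bool as Bool using (Bool; true; false; if_then_else_; _∧_; not)
open import Data.Bool.Properties using (∨-conicalˡ; ∨-conicalʳ; ∧-conicalˡ; ∧-conicalʳ; not-injective)
open import Data.Empty using (⊥; ⊥-elim)
open import Data.Fin using (Fin; zero; suc; _≟_)
open import Data.Fin.Properties using (suc-injective; any?)
import Data.Fin.Subset as Subset
open import Data.Fin.Subset.Induction using (⊂-wellFounded)
open import Data.Integer as ℤ using (ℤ)
import Data.Integer.Properties as ℤ
open import Data.List using (List; []; _∷_; allFin)
open import Data.List.Membership.Propositional using (_∈_; _∉_; lose)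
open import Data.List.Membership.Propositional.Properties using (∈-allFin)
open import Data.List.Relation.Unary.All using (All; []; _∷_; lookup)
open import Data.List.Relation.Unary.All.Properties using (¬Any⇒All¬)
open import Data.List.Relation.Unary.AllPairs using ([]; _∷_)
open import Data.List.Relation.Unary.Any using (Any; here; there) renaming (any? to anyᴸ?)
open import Data.List.Relation.Unary.Unique.Propositional using (Unique)
open import Data.Nat as ℕ using (ℕ)
open import Data.Product as Product using (∃; _×_; _,_; proj₁; proj₂)
open import Data.Product.Relation.Binary.Lex.Strict using (×-Lex; ×-decidable)
open import Data.Rational as ℚ using (ℚ)
import Data.Rational.Properties as ℚ
open import Data.Sum as Sum using (_⊎_; inj₁; inj₂; [_,_]′)
open import Data.Unit using (⊤; tt)
open import Data.Vec using (tabulate)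
open import Data.Vec.Functional using (updateAt)
open import Data.Vec.Functional.Properties using (updateAt-updates; updateAt-minimal)
open import Data.Vec.Properties using (lookup∘tabulate; []=⇒lookup; lookup⇒[]=)
open import Effect.Monad using (RawMonad)
open import Function using (_∘_; id; flip; _⇔_; mk⇔)
open import Induction.WellFounded using (Acc; acc)
open import Level using (0ℓ)
open import Relation.Binary using (Rel; Total; Transitive; tri<; tri≈; tri>)
open import Relation.Binary.Bundles using (StrictTotalOrder)
import Relation.Binary.Construct.Flip.EqAndOrd as Flip
open import Relation.Binary.Definitions using (Dense)
open import Relation.Binary.PropositionalEquality
  using (_≡_; _≢_; refl; sym; trans; cong; cong₂; subst; subst₂; module ≡-Reasoning)
open import Relation.Nullary using (¬_; yes; no; contradiction)
open import Relation.Nullary.Decidable using (_×-dec_; decidable-stable; ¬¬-excluded-middle)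
open import Relation.Nullary.Negation using (¬¬-Monad)

open RawMonad {0ℓ} ¬¬-Monad using (_>>=_; return)

¬¬⊥⇒⊥ : ¬ ¬ ⊥ → ⊥
¬¬⊥⇒⊥ ¬¬⊥ = ¬¬⊥ id

¬¬-minimal : ∀ {A : Set} {R : Rel A 0ℓ} → Total R → Transitive R →
             (P : A → Set) (xs : List A) → Any P xs →
             ¬ ¬ (∃ λ j → j ∈ xs × P j × ∀ {k} → k ∈ xs → P k → R j k)
¬¬-minimal {R = R} total R-trans P (x ∷ xs) P-somewhere = do
  yes P-in-xs ← ¬¬-excluded-middle
    where no ¬P-in-xs → return (x , here refl , P-head P-somewhere ¬P-in-xs , λ where
            (here refl) _  → R-refl
            (there k∈)  Pk → contradiction (lose k∈ Pk) ¬P-in-xs)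
  (j , j∈ , Pj , j-min) ← ¬¬-minimal total R-trans P xs P-in-xs
  yes Px ← ¬¬-excluded-middle
    where no ¬Px → return (j , there j∈ , Pj , λ where
            (here refl) Pk → contradiction Pk ¬Px
            (there k∈)  Pk → j-min k∈ Pk)
  return ([ (λ xRj → x , here refl , Px , λ where
              (here refl) _  → R-refl
              (there k∈)  Pk → R-trans xRj (j-min k∈ Pk))
          , (λ jRx → j , there j∈ , Pj , λ where
              (here refl) _  → jRx
              (there k∈)  Pk → j-min k∈ Pk)
          ]′ (total x j))
  where
  R-refl : R x x
  R-refl = [ id , id ]′ (total x x)
  P-head : Any P (x ∷ xs) → ¬ Any P xs → P x
  P-head (here Px) _ = Px
  P-head (there P-in-xs) ¬P-in-xs = contradiction P-in-xs ¬P-in-xs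

module _ (O : StrictTotalOrder 0ℓ 0ℓ 0ℓ) (dense : Dense (StrictTotalOrder._<_ O)) where
  open StrictTotalOrder O using (Carrier; _<_; _<?_; compare; <-respˡ-≈; module Eq) renaming (trans to <-trans)

  ∃-between-below-all : ∀ {k} {l u} → l < u → (v : Fin k → Carrier) →
                        ∃ λ a → l < a × a < u × ∀ i → l < v i → a < v i
  ∃-between-below-all {ℕ.zero} l<u v with dense l<u
  ... | a , l<a , a<u = a , l<a , a<u , λ ()
  ∃-between-below-all {ℕ.suc k} l<u v with ∃-between-below-all l<u (v ∘ suc)
  ... | a , l<a , a<u , below with _ <? v zero
  ...   | no l≮v₀ = a , l<a , a<u , λ { zero l<v₀ → contradiction l<v₀ l≮v₀ ; (suc i) → below i }
  ...   | yes l<v₀ with dense l<v₀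
  ...     | b , l<b , b<v₀ with compare a b
  ...       | tri< a<b _ _ = a , l<a , a<u , λ { zero _ → <-trans a<b b<v₀ ; (suc i) → below i }
  ...       | tri≈ _ a≈b _ = a , l<a , a<u , λ { zero _ → <-respˡ-≈ (Eq.sym a≈b) b<v₀ ; (suc i) → below i }
  ...       | tri> _ _ b<a = b , l<b , <-trans b<a a<u ,
                             λ { zero _ → b<v₀ ; (suc i) l<v → <-trans b<a (below i l<v) }

∃-between-below-allℚ : ∀ {k} {l u} → l ℚ.< u → (v : Fin k → ℚ) →
                       ∃ λ a → l ℚ.< a × a ℚ.< u × ∀ i → l ℚ.< v i → a ℚ.< v i
∃-between-below-allℚ = ∃-between-below-all ℚ.<-strictTotalOrder ℚ.<-dense

∃-between-above-allℚ : ∀ {k} {l u} → l ℚ.< u → (v : Fin k → ℚ) →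
                       ∃ λ b → l ℚ.< b × b ℚ.< u × ∀ i → v i ℚ.< u → v i ℚ.< b
∃-between-above-allℚ l<u v =
  let (b , b<u , l<b , above) =
        ∃-between-below-all (Flip.strictTotalOrder ℚ.<-strictTotalOrder) flip-dense l<u v
  in b , l<b , b<u , above
  where
  flip-dense : Dense (flip ℚ._<_)
  flip-dense q<p = let (m , q<m , m<p) = ℚ.<-dense q<p in m , m<p , q<m

module MaskedSum (M : CommutativeMonoid 0ℓ 0ℓ) where
  open CommutativeMonoid M
    using (_∙_; ε; _≈_; setoid; assoc; identityʳ; ∙-congˡ; ∙-congʳ; commutativeSemigroup)
    renaming (Carrier to A)
  open CommutativeSemigroupProperties commutativeSemigroup using (xy∙z≈zy∙x; xy∙z≈xz∙y)
  open import Relation.Binary.Reasoning.Setoid setoid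

  masked : Bool → A → A
  masked b a = if b then a else ε

  sum : ∀ {k} → (Fin k → Bool) → (Fin k → A) → A
  sum {ℕ.zero}  S w = ε
  sum {ℕ.suc k} S w = masked (S zero) (w zero) ∙ sum (S ∘ suc) (w ∘ suc)

  sum-cong : ∀ {k} {S S' : Fin k → Bool} (w : Fin k → A) → (∀ i → S i ≡ S' i) → sum S w ≡ sum S' w
  sum-cong {ℕ.zero}  w S≗S' = refl
  sum-cong {ℕ.suc k} w S≗S' =
    cong₂ (λ b s → masked b (w zero) ∙ s) (S≗S' zero) (sum-cong (w ∘ suc) (S≗S' ∘ suc))

  sum-update : ∀ {k} {S S' : Fin k → Bool} (w : Fin k → A) (e : Fin k) → (∀ i → i ≢ e → S i ≡ S' i) →
               sum S w ∙ masked (S' e) (w e) ≈ sum S' w ∙ masked (S e) (w e)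
  sum-update {S = S} {S'} w zero agree = begin
    (masked (S zero) (w zero) ∙ sum (S ∘ suc) (w ∘ suc)) ∙ masked (S' zero) (w zero)
      ≡⟨ cong (λ s → (masked (S zero) (w zero) ∙ s) ∙ masked (S' zero) (w zero))
              (sum-cong (w ∘ suc) (λ i → agree (suc i) λ ())) ⟩
    (masked (S zero) (w zero) ∙ sum (S' ∘ suc) (w ∘ suc)) ∙ masked (S' zero) (w zero)
      ≈⟨ xy∙z≈zy∙x _ _ _ ⟩
    (masked (S' zero) (w zero) ∙ sum (S' ∘ suc) (w ∘ suc)) ∙ masked (S zero) (w zero) ∎
  sum-update {S = S} {S'} w (suc e) agree = begin
    (masked (S zero) (w zero) ∙ sum (S ∘ suc) (w ∘ suc)) ∙ masked (S' (suc e)) (w (suc e))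
      ≈⟨ assoc _ _ _ ⟩
    masked (S zero) (w zero) ∙ (sum (S ∘ suc) (w ∘ suc) ∙ masked (S' (suc e)) (w (suc e)))
      ≈⟨ ∙-congˡ (sum-update (w ∘ suc) e (λ i i≢e → agree (suc i) (i≢e ∘ suc-injective))) ⟩
    masked (S zero) (w zero) ∙ (sum (S' ∘ suc) (w ∘ suc) ∙ masked (S (suc e)) (w (suc e)))
      ≈⟨ assoc _ _ _ ⟨
    (masked (S zero) (w zero) ∙ sum (S' ∘ suc) (w ∘ suc)) ∙ masked (S (suc e)) (w (suc e))
      ≡⟨ cong (λ b → (masked b (w zero) ∙ sum (S' ∘ suc) (w ∘ suc)) ∙ masked (S (suc e)) (w (suc e)))
              (agree zero λ ()) ⟩
    (masked (S' zero) (w zero) ∙ sum (S' ∘ suc) (w ∘ suc)) ∙ masked (S (suc e)) (w (suc e)) ∎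

  sum-swap : ∀ {k} {S S' : Fin k → Bool} (w : Fin k → A) {x y : Fin k} →
             S x ≡ true → S y ≡ false → S' x ≡ false → S' y ≡ true →
             (∀ i → i ≢ x → i ≢ y → S i ≡ S' i) → sum S' w ∙ w x ≈ sum S w ∙ w y
  sum-swap {k} {S} {S'} w {x} {y} Sx Sy S'x S'y agree = begin
    sum S' w ∙ w x                          ≈⟨ ∙-congʳ (identityʳ _) ⟨
    (sum S' w ∙ ε) ∙ w x                    ≡⟨ cong (λ b → (sum S' w ∙ masked b (w y)) ∙ w x) Ry ⟨
    (sum S' w ∙ masked (R y) (w y)) ∙ w x   ≈⟨ ∙-congʳ (sum-update w y S'≗R) ⟩
    (sum R w ∙ masked (S' y) (w y)) ∙ w x   ≡⟨ cong (λ b → (sum R w ∙ masked b (w y)) ∙ w x) S'y ⟩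
    (sum R w ∙ w y) ∙ w x                   ≈⟨ xy∙z≈xz∙y _ _ _ ⟩
    (sum R w ∙ w x) ∙ w y                   ≡⟨ cong (λ b → (sum R w ∙ masked b (w x)) ∙ w y) Sx ⟨
    (sum R w ∙ masked (S x) (w x)) ∙ w y    ≈⟨ ∙-congʳ (sum-update w x R≗S) ⟩
    (sum S w ∙ masked (R x) (w x)) ∙ w y    ≡⟨ cong (λ b → (sum S w ∙ masked b (w x)) ∙ w y) Rx ⟩
    (sum S w ∙ ε) ∙ w y                     ≈⟨ ∙-congʳ (identityʳ _) ⟩
    sum S w ∙ w y                           ∎
    where
    R : Fin k → Bool
    R = updateAt S x (λ _ → false)
    Rx : R x ≡ false
    Rx = updateAt-updates x S
    R≗S : ∀ i → i ≢ x → R i ≡ S i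
    R≗S i i≢x = updateAt-minimal i x S i≢x
    Ry : R y ≡ false
    Ry = trans (R≗S y λ { refl → contradiction (trans (sym Sx) Sy) λ () }) Sy
    S'≗R : ∀ i → i ≢ y → S' i ≡ R i
    S'≗R i i≢y with i ≟ x
    ... | yes refl = trans S'x (sym Rx)
    ... | no i≢x = trans (sym (agree i i≢x i≢y)) (sym (R≗S i i≢x))

sumℚ≡sum : ∀ {k} (S : Fin k → Bool) (w : Fin k → ℚ) →
           sumℚ S w ≡ MaskedSum.sum ℚ.+-0-commutativeMonoid S w
sumℚ≡sum {ℕ.zero}  S w = refl
sumℚ≡sum {ℕ.suc k} S w =
  cong ((if S zero then w zero else ℚ.0ℚ) ℚ.+_) (sumℚ≡sum (S ∘ suc) (w ∘ suc))

sumℤ≡sum : ∀ {k} (S : Fin k → Bool) (t : Fin k → ℤ) →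
           sumℤ S t ≡ MaskedSum.sum ℤ.+-0-commutativeMonoid S t
sumℤ≡sum {ℕ.zero}  S t = refl
sumℤ≡sum {ℕ.suc k} S t =
  cong (λ s → (if S zero then t zero else ℤ.+ 0) ℤ.+ s) (sumℤ≡sum (S ∘ suc) (t ∘ suc))

+-cancelˡ-≤ℚ : ∀ {a b c d} → a ℚ.+ b ≡ c ℚ.+ d → c ℚ.≤ a → b ℚ.≤ d
+-cancelˡ-≤ℚ {a} {b} {c} {d} eq c≤a = ℚ.≮⇒≥ λ d<b →
  ℚ.<-irrefl (sym eq) (ℚ.<-≤-trans (ℚ.+-monoʳ-< c d<b) (ℚ.+-monoˡ-≤ b c≤a))

+-cancelˡ-<ℚ : ∀ {a b c d} → a ℚ.+ b ≡ c ℚ.+ d → c ℚ.< a → b ℚ.< d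
+-cancelˡ-<ℚ {a} {b} {c} {d} eq c<a = ℚ.≰⇒> λ d≤b →
  ℚ.<-irrefl (sym eq) (ℚ.≤-<-trans (ℚ.+-monoʳ-≤ c d≤b) (ℚ.+-monoˡ-< b c<a))

+-cancelʳ-≤ℚ : ∀ {a b c d} → a ℚ.+ b ≡ c ℚ.+ d → d ℚ.≤ b → a ℚ.≤ c
+-cancelʳ-≤ℚ {a} {b} {c} {d} eq = +-cancelˡ-≤ℚ (trans (ℚ.+-comm b a) (trans eq (ℚ.+-comm c d)))

+-cancelʳ-≤ℤ : ∀ {a b c d} → a ℤ.+ b ≡ c ℤ.+ d → d ℤ.≤ b → a ℤ.≤ c
+-cancelʳ-≤ℤ {a} {b} {c} {d} eq d≤b = ℤ.≮⇒≥ λ c<a →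
  ℤ.<-irrefl (sym eq) (ℤ.≤-<-trans (ℤ.+-monoʳ-≤ c d≤b) (ℤ.+-monoˡ-< b c<a))

tabulate-⊂ : ∀ {k} {P P' : Fin k → Bool} → (∀ i → P i ≡ true → P' i ≡ true) →
             ∀ j → P j ≡ false → P' j ≡ true → tabulate P Subset.⊂ tabulate P'
tabulate-⊂ {k} {P} {P'} P⇒P' j Pj P'j =
  (λ {i} i∈P → ∈-tabulate (P⇒P' i (tabulate-∈ i∈P))) , j , ∈-tabulate P'j ,
  λ j∈P → contradiction (trans (sym (tabulate-∈ j∈P)) Pj) λ ()
  where
  tabulate-∈ : ∀ {Q : Fin k → Bool} {i} → i Subset.∈ tabulate Q → Q i ≡ true
  tabulate-∈ {Q} {i} i∈Q = trans (sym (lookup∘tabulate Q i)) ([]=⇒lookup i∈Q)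
  ∈-tabulate : ∀ {Q : Fin k → Bool} {i} → Q i ≡ true → i Subset.∈ tabulate Q
  ∈-tabulate {Q} {i} Qi = lookup⇒[]= i (tabulate Q) (trans (lookup∘tabulate Q i) Qi)

module _ (g : Graph) where

  Edge : Set
  Edge = Fin (m g)

  Vertex : Set
  Vertex = Fin (n g)

  private variable
    S S' T T' : EdgeSet g
    e f h x y : Edge
    p q r u v : Vertex
    es : List Edge
    vs : List Vertex
    w c : Edge → ℚ
    t : Edge → ℤ

  _⊆_ : EdgeSet g → EdgeSet g → Set
  S ⊆ S' = ∀ e → S e ≡ true → S' e ≡ true

  insert : EdgeSet g → Edge → EdgeSet g
  insert S y = updateAt S y (λ _ → true)

  ∈-∉-≢ : S e ≡ true → S f ≡ false → e ≢ f
  ∈-∉-≢ Se Sf refl = contradiction (trans (sym Se) Sf) λ ()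

  remove-≢ : e ≢ x → remove g S x e ≡ S e
  remove-≢ {e = e} {x = x} e≢x with e ≟ x
  ... | yes e≡x = contradiction e≡x e≢x
  ... | no _    = refl

  remove-self : ∀ S x → remove g S x x ≡ false
  remove-self S x with x ≟ x
  ... | yes _   = refl
  ... | no x≢x = contradiction refl x≢x

  remove-true : ∀ S x e → remove g S x e ≡ true → S e ≡ true × e ≢ x
  remove-true S x e Se with e ≟ x
  ... | no e≢x = Se , e≢x

  remove-⊆ : ∀ S x → remove g S x ⊆ S
  remove-⊆ S x e Se = proj₁ (remove-true S x e Se)

  insert-self : ∀ S y → insert S y y ≡ true
  insert-self S y = updateAt-updates y S

  insert-≢ : ∀ S → e ≢ y → insert S y e ≡ S e
  insert-≢ {e = e} {y = y} S e≢y = updateAt-minimal e y S e≢y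

  ⊆-insert : ∀ S y → S ⊆ insert S y
  ⊆-insert S y e Se with e ≟ y
  ... | yes refl = insert-self S y
  ... | no e≢y   = trans (insert-≢ S e≢y) Se

  remove-mono : ∀ S S' x → S ⊆ S' → remove g S x ⊆ remove g S' x
  remove-mono S S' x S⊆S' e Se with remove-true S x e Se
  ... | Se , e≢x = trans (remove-≢ {S = S'} e≢x) (S⊆S' e Se)

  ⊆-by-remove : ∀ S x → remove g S x ⊆ S' → S' x ≡ true → S ⊆ S'
  ⊆-by-remove S x sub S'x e Se with e ≟ x
  ... | yes refl = S'x
  ... | no e≢x   = sub e (trans (remove-≢ {S = S} e≢x) Se)

  -- Walks and connectivity

  step-sym : Step g e u v → Step g e v u
  step-sym (inj₁ (a , b)) = inj₂ (b , a)
  step-sym (inj₂ (a , b)) = inj₁ (b , a)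

  walk-mono : S ⊆ S' → Walk g S u v es vs → Walk g S' u v es vs
  walk-mono S⊆S' done            = done
  walk-mono S⊆S' (step Se st walk) = step (S⊆S' _ Se) st (walk-mono S⊆S' walk)

  connected-mono : S ⊆ S' → Connected g S u v → Connected g S' u v
  connected-mono S⊆S' (es , vs , walk) = es , vs , walk-mono S⊆S' walk

  connected-refl : Connected g S u u
  connected-refl = [] , _ , done

  connected-step : S e ≡ true → Step g e u v → Connected g S v r → Connected g S u r
  connected-step Se st (es , vs , walk) = _ , _ , step Se st walk

  connected-trans : Connected g S u v → Connected g S v r → Connected g S u r
  connected-trans (_ , _ , done)            vr = vr
  connected-trans (_ , _ , step Se st walk) vr = connected-step Se st (connected-trans (_ , _ , walk) vr)

  connected-sym : Connected g S u v → Connected g S v u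
  connected-sym (_ , _ , done)            = connected-refl
  connected-sym (_ , _ , step Se st walk) =
    connected-trans (connected-sym (_ , _ , walk)) (connected-step Se (step-sym st) connected-refl)

  Joins : EdgeSet g → Edge → Set
  Joins S e = Connected g S (src g e) (tgt g e)

  -- For a spanning tree T and an edge f ∉ T, Essential T x f says that x lies on the cycle closed by f.
  Essential : EdgeSet g → Edge → Edge → Set
  Essential S x e = ¬ Joins (remove g S x) e

  edge-joins : S e ≡ true → Joins S e
  edge-joins Se = connected-step Se (inj₁ (refl , refl)) connected-refl

  step-joins : Step g e u v → Connected g S u v → Joins S e
  step-joins (inj₁ (refl , refl)) uv = uv
  step-joins (inj₂ (refl , refl)) uv = connected-sym uv

  joins-step : Step g e u v → Joins S e → Connected g S u v
  joins-step (inj₁ (refl , refl)) joins = joins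
  joins-step (inj₂ (refl , refl)) joins = connected-sym joins

  walk-edge : Walk g S u v es vs → e ∈ es → S e ≡ true
  walk-edge (step Se _ _)    (here refl) = Se
  walk-edge (step _ _ walk) (there e∈)  = walk-edge walk e∈

  walk-head : Walk g S u v es vs → u ∈ vs
  walk-head done          = here refl
  walk-head (step _ _ _)  = here refl

  walk-ends : Walk g S u v es vs → e ∈ es → src g e ∈ vs × tgt g e ∈ vs
  walk-ends (step _ (inj₁ (refl , refl)) walk) (here refl) = here refl , there (walk-head walk)
  walk-ends (step _ (inj₂ (refl , refl)) walk) (here refl) = there (walk-head walk) , here refl
  walk-ends (step _ _ walk) (there e∈) with walk-ends walk e∈
  ... | s∈ , t∈ = there s∈ , there t∈

  walk-avoid : Walk g S u v es vs → x ∉ es → Walk g (remove g S x) u v es vs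
  walk-avoid done x∉ = done
  walk-avoid {S = S} (step Se st walk) x∉ =
    step (trans (remove-≢ {S = S} λ { refl → x∉ (here refl) }) Se) st (walk-avoid walk (x∉ ∘ there))

  step-unused : Step g e u v → All (u ≢_) vs → Walk g S v r es vs → e ∉ es
  step-unused (inj₁ (refl , _)) u∉vs walk e∈ = lookup u∉vs (proj₁ (walk-ends walk e∈)) refl
  step-unused (inj₂ (refl , _)) u∉vs walk e∈ = lookup u∉vs (proj₂ (walk-ends walk e∈)) refl

  path-edge-disconnects : Acyclic g S → Walk g S u v es vs → Unique vs → x ∈ es →
                          ¬ Connected g (remove g S x) u v
  path-edge-disconnects {S = S} {v = v} acyclic (step {e = e} {x = r} Se st walk) (u∉vs ∷ _) (here refl) uv =
    acyclic (e , Se , step-joins st (connected-trans uv (connected-sym rest)))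
    where rest : Connected g (remove g S e) r v
          rest = _ , _ , walk-avoid walk (step-unused st u∉vs walk)
  path-edge-disconnects {x = x} acyclic (step {e = e} Se st walk) (u∉vs ∷ unique) (there x∈) uv with e ≟ x
  ... | yes refl = step-unused st u∉vs walk x∈
  ... | no e≢x   = path-edge-disconnects acyclic walk unique x∈
                     (connected-step (trans (remove-≢ e≢x) Se) (step-sym st) uv)

  walk-suffix : Walk g S r v es vs → Unique vs → u ∈ vs → ∃ λ es' → Path g S u v es'
  walk-suffix done                unique       (here refl) = _ , _ , done , unique
  walk-suffix walk@(step _ _ _)   unique       (here refl) = _ , _ , walk , unique
  walk-suffix (step _ _ walk)     (_ ∷ unique) (there u∈)  = walk-suffix walk unique u∈

  walk⇒path : Walk g S u v es vs → ∃ λ es' → Path g S u v es'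
  walk⇒path done = [] , _ , done , [] ∷ []
  walk⇒path (step {u = u} Se st walk) with walk⇒path walk
  ... | _ , vs' , path , unique with anyᴸ? (u ≟_) vs'
  ...   | yes u∈ = walk-suffix path unique u∈
  ...   | no u∉  = _ , u ∷ vs' , step Se st path , ¬Any⇒All¬ vs' u∉ ∷ unique

  connected⇒path : Connected g S u v → ∃ λ es → Path g S u v es
  connected⇒path (_ , _ , walk) = walk⇒path walk

  inCycle⇒∈ : InCycleMinus g T f x → T x ≡ true
  inCycle⇒∈ (_ , (_ , walk , _) , x∈) = walk-edge walk x∈

  inCycle⇒essential : Acyclic g T → InCycleMinus g T f x → Essential T x f
  inCycle⇒essential acyclic (_ , (_ , walk , unique) , x∈) = path-edge-disconnects acyclic walk unique x∈

  essential⇒inCycle : (∀ u v → Connected g T u v) → Essential T x f → InCycleMinus g T f x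
  essential⇒inCycle {x = x} {f = f} span ess with connected⇒path (span (src g f) (tgt g f))
  ... | es , vs , walk , unique with anyᴸ? (x ≟_) es
  ...   | yes x∈ = es , (vs , walk , unique) , x∈
  ...   | no x∉  = contradiction (_ , _ , walk-avoid walk x∉) ess

  essential⇒∈ : Joins T f → Essential T x f → T x ≡ true
  essential⇒∈ {T = T} {x = x} joins ess with T x in Tx
  ... | true  = refl
  ... | false = contradiction (connected-mono T⊆T-x joins) ess
    where T⊆T-x : T ⊆ remove g T x
          T⊆T-x e Te = trans (remove-≢ {S = T} (∈-∉-≢ {S = T} Te Tx)) Te

  essential⇒∉ : Essential S h e → e ≢ h → S e ≡ false
  essential⇒∉ {S = S} {e = e} ess e≢h with S e in Se
  ... | true  = contradiction (edge-joins (trans (remove-≢ e≢h) Se)) ess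
  ... | false = refl

  walk-crossing : Walk g S' u v es vs → ¬ Connected g S u v → ¬ ¬ ∃ λ h → h ∈ es × ¬ Joins S h
  walk-crossing done ¬uv = contradiction connected-refl ¬uv
  walk-crossing (step {e = e} _ st walk) ¬uv = do
    yes rv ← ¬¬-excluded-middle
      where no ¬rv → do (h , h∈ , ¬joins) ← walk-crossing walk ¬rv
                        return (h , there h∈ , ¬joins)
    return (e , here refl , λ joins → ¬uv (connected-trans (joins-step st joins) rv))

  path-second-crossing : Walk g S' u v es vs → Unique vs → x ∈ es → ¬ Joins S x → Connected g S u v →
                         ¬ ¬ ∃ λ h → h ∈ es × h ≢ x × ¬ Joins S h
  path-second-crossing (step _ st walk) (u∉vs ∷ _) (here refl) ¬joins uv = do
    (h , h∈ , ¬joins-h) ←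
      walk-crossing walk λ rv → ¬joins (step-joins st (connected-trans uv (connected-sym rv)))
    return (h , there h∈ , (λ { refl → step-unused st u∉vs walk h∈ }) , ¬joins-h)
  path-second-crossing (step {e = e} _ st walk) (u∉vs ∷ unique) (there x∈) ¬joins uv = do
    yes ur ← ¬¬-excluded-middle
      where no ¬ur → return (e , here refl , (λ { refl → step-unused st u∉vs walk x∈ }) ,
                             ¬ur ∘ joins-step st)
    (h , h∈ , h≢x , ¬joins-h) ←
      path-second-crossing walk unique x∈ ¬joins (connected-trans (connected-sym ur) uv)
    return (h , there h∈ , h≢x , ¬joins-h)

  cycle-crossing : SpanningTree g T → ¬ Joins S f →
                   ¬ ¬ ∃ λ h → T h ≡ true × Essential T h f × ¬ Joins S h
  cycle-crossing {f = f} (span , acyclic) ¬joins with connected⇒path (span (src g f) (tgt g f))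
  ... | _ , _ , walk , unique = do
    (h , h∈ , ¬joins-h) ← walk-crossing walk ¬joins
    return (h , walk-edge walk h∈ , path-edge-disconnects acyclic walk unique h∈ , ¬joins-h)

  symmetric-exchange : SpanningTree g T → SpanningTree g T' → T x ≡ true → T' x ≡ false →
                       ¬ ¬ ∃ λ y → T' y ≡ true × T y ≡ false × Essential T x y × Essential T' y x
  symmetric-exchange (_ , acyclic) tree' Tx T'x = do
    (y , T'y , essential' , essential) ← cycle-crossing tree' λ joins → acyclic (_ , Tx , joins)
    return (y , T'y , essential⇒∉ essential (∈-∉-≢ T'y T'x) , essential , essential')

  -- Exchange

  Through : EdgeSet g → Edge → Vertex → Vertex → Set
  Through S y p q = (Connected g S p (src g y) × Connected g S (tgt g y) q)
                  ⊎ (Connected g S p (tgt g y) × Connected g S (src g y) q)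

  through-mono : S ⊆ S' → Through S y p q → Through S' y p q
  through-mono S⊆S' (inj₁ (ps , tq)) = inj₁ (connected-mono S⊆S' ps , connected-mono S⊆S' tq)
  through-mono S⊆S' (inj₂ (pt , sq)) = inj₂ (connected-mono S⊆S' pt , connected-mono S⊆S' sq)

  through-prepend : Connected g S p q → Through S y q r → Through S y p r
  through-prepend pq (inj₁ (qs , tr)) = inj₁ (connected-trans pq qs , tr)
  through-prepend pq (inj₂ (qt , sr)) = inj₂ (connected-trans pq qt , sr)

  through-step : Step g y p q → Connected g S q r → Through S y p r
  through-step (inj₁ (refl , refl)) qr = inj₁ (connected-refl , qr)
  through-step (inj₂ (refl , refl)) qr = inj₂ (connected-refl , qr)

  through-step-ends : Step g y p q → Through S y q r → Connected g S p r ⊎ Connected g S q r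
  through-step-ends (inj₁ (refl , refl)) (inj₁ (_ , tr)) = inj₂ tr
  through-step-ends (inj₁ (refl , refl)) (inj₂ (_ , sr)) = inj₁ sr
  through-step-ends (inj₂ (refl , refl)) (inj₁ (_ , tr)) = inj₁ tr
  through-step-ends (inj₂ (refl , refl)) (inj₂ (_ , sr)) = inj₂ sr

  through-cycle : Through S y p q → Connected g S q p → Joins S y
  through-cycle (inj₁ (ps , tq)) qp = connected-trans (connected-sym ps) (connected-sym (connected-trans tq qp))
  through-cycle (inj₂ (pt , sq)) qp = connected-trans sq (connected-trans qp pt)

  through-insert : Walk g (insert S y) p q es vs → ¬ Connected g S p q → ¬ ¬ Through S y p q
  through-insert done ¬pq = contradiction connected-refl ¬pq
  through-insert {S = S} {y = y} (step {e = e} Se st walk) ¬pq with e ≟ y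
  ... | no e≢y = do
    through ← through-insert walk (¬pq ∘ connected-step S∋e st)
    return (through-prepend (connected-step S∋e st connected-refl) through)
    where S∋e : S e ≡ true
          S∋e = trans (sym (insert-≢ S e≢y)) Se
  ... | yes refl = do
    yes rq ← ¬¬-excluded-middle
      where no ¬rq → do through ← through-insert walk ¬rq
                        return (⊥-elim ([ ¬pq , ¬rq ]′ (through-step-ends st through)))
    return (through-step st rq)

  walk-reroute : Joins S' x → remove g S x ⊆ S' → Walk g S u v es vs → Connected g S' u v
  walk-reroute joins sub done = connected-refl
  walk-reroute {x = x} {S = S} joins sub (step {e = e} Se st walk) with e ≟ x
  ... | yes refl = connected-trans (joins-step st joins) (walk-reroute joins sub walk)
  ... | no e≢x   = connected-step (sub e (trans (remove-≢ {S = S} e≢x) Se)) st (walk-reroute joins sub walk)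

  exchange : SpanningTree g T → T x ≡ true → Essential T x y → ¬ ¬ SpanningTree g (insert (remove g T x) y)
  exchange {T = T} {x = x} {y = y} (span , acyclic) Tx essential = do
    x-joined ← joins-x
    return ((λ u v → let (_ , _ , walk) = span u v in walk-reroute x-joined (⊆-insert T-x y) walk) , acyclic')
    where
    T-x : EdgeSet g
    T-x = remove g T x
    T-x+y : EdgeSet g
    T-x+y = insert T-x y

    joins-x : ¬ ¬ Joins T-x+y x
    joins-x = do
      let (_ , _ , walk) = span (src g y) (tgt g y)
      through ← through-insert (walk-mono (⊆-by-remove T x (⊆-insert T-x x) (insert-self T-x x)) walk) essential
      return (through-cycle (through-mono (⊆-insert T-x y) through)
                            (connected-sym (edge-joins (insert-self T-x y))))

    acyclic' : Acyclic g T-x+y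
    acyclic' (e , e∈ , joins) with e ≟ y
    ... | yes refl = essential (connected-mono drop-y joins)
      where drop-y : remove g T-x+y y ⊆ T-x
            drop-y e' e'∈ with remove-true T-x+y y e' e'∈
            ... | e'∈ , e'≢y = trans (sym (insert-≢ T-x e'≢y)) e'∈
    ... | no e≢y = ¬¬⊥⇒⊥ do
      let T-x∋e = trans (sym (insert-≢ T-x e≢y)) e∈
      no ¬joins ← ¬¬-excluded-middle
        where yes joins → return (acyclic (e , remove-⊆ T x e T-x∋e ,
                                             connected-mono (remove-mono T-x T e (remove-⊆ T x)) joins))
      through ← through-insert (walk-mono swap-order (proj₂ (proj₂ joins))) ¬joins
      return (essential (through-cycle (through-mono (remove-⊆ T-x e) through)
                                       (connected-sym (edge-joins T-x∋e))))
      where swap-order : remove g T-x+y e ⊆ insert (remove g T-x e) y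
            swap-order e' e'∈ with remove-true T-x+y e e' e'∈ | e' ≟ y
            ... | _ , _      | yes refl = insert-self _ y
            ... | e'∈ , e'≢e | no e'≢y  =
              trans (insert-≢ _ e'≢y)
                    (trans (remove-≢ {S = T-x} e'≢e) (trans (sym (insert-≢ T-x e'≢y)) e'∈))

  -- Minimum spanning trees

  exchange-drops : T x ≡ true → T y ≡ false → insert (remove g T x) y x ≡ false
  exchange-drops {T = T} {x = x} Tx Ty = trans (insert-≢ _ (∈-∉-≢ {S = T} Tx Ty)) (remove-self T x)

  exchange-keeps : ∀ i → i ≢ x → i ≢ y → T i ≡ insert (remove g T x) y i
  exchange-keeps {T = T} i i≢x i≢y = sym (trans (insert-≢ _ i≢y) (remove-≢ {S = T} i≢x))

  sumℚ-exchange : ∀ (w : Edge → ℚ) → T x ≡ true → T y ≡ false →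
                  sumℚ (insert (remove g T x) y) w ℚ.+ w x ≡ sumℚ T w ℚ.+ w y
  sumℚ-exchange {T = T} {x = x} {y = y} w Tx Ty = begin
    sumℚ T-x+y w ℚ.+ w x  ≡⟨ cong (ℚ._+ w x) (sumℚ≡sum T-x+y w) ⟩
    sum T-x+y w ℚ.+ w x   ≡⟨ sum-swap w Tx Ty (exchange-drops Tx Ty) (insert-self _ y) exchange-keeps ⟩
    sum T w ℚ.+ w y       ≡⟨ cong (ℚ._+ w y) (sumℚ≡sum T w) ⟨
    sumℚ T w ℚ.+ w y      ∎
    where
    open ≡-Reasoning
    open MaskedSum ℚ.+-0-commutativeMonoid using (sum; sum-swap)
    T-x+y : EdgeSet g
    T-x+y = insert (remove g T x) y

  sumℤ-exchange : ∀ (t : Edge → ℤ) → T x ≡ true → T y ≡ false →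
                  sumℤ (insert (remove g T x) y) t ℤ.+ t x ≡ sumℤ T t ℤ.+ t y
  sumℤ-exchange {T = T} {x = x} {y = y} t Tx Ty = begin
    sumℤ T-x+y t ℤ.+ t x  ≡⟨ cong (ℤ._+ t x) (sumℤ≡sum T-x+y t) ⟩
    sum T-x+y t ℤ.+ t x   ≡⟨ sum-swap t Tx Ty (exchange-drops Tx Ty) (insert-self _ y) exchange-keeps ⟩
    sum T t ℤ.+ t y       ≡⟨ cong (ℤ._+ t y) (sumℤ≡sum T t) ⟨
    sumℤ T t ℤ.+ t y      ∎
    where
    open ≡-Reasoning
    open MaskedSum ℤ.+-0-commutativeMonoid using (sum; sum-swap)
    T-x+y : EdgeSet g
    T-x+y = insert (remove g T x) y

  _∖_ : EdgeSet g → EdgeSet g → EdgeSet g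
  (S ∖ S') e = S e ∧ not (S' e)

  ∈-∖ : S e ≡ true → S' e ≡ false → (S ∖ S') e ≡ true
  ∈-∖ Se S'e = cong₂ (λ a b → a ∧ not b) Se S'e

  ∈-∖⁻ : ∀ S S' e → (S ∖ S') e ≡ true → S e ≡ true × S' e ≡ false
  ∈-∖⁻ S S' e e∈ =
    ∧-conicalˡ (S e) (not (S' e)) e∈ , not-injective (∧-conicalʳ (S e) (not (S' e)) e∈)

  exchange-∖-⊂ : T' h ≡ true → T h ≡ false → T x ≡ true → T' x ≡ false →
                 tabulate (insert (remove g T' h) x ∖ T) Subset.⊂ tabulate (T' ∖ T)
  exchange-∖-⊂ {T' = T'} {h = h} {T = T} {x = x} T'h Th Tx T'x =
    tabulate-⊂ fewer h (cong (_∧ not (T h)) (exchange-drops T'h T'x)) (∈-∖ {S = T'} {S' = T} T'h Th)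
    where
    fewer : ∀ e → (insert (remove g T' h) x ∖ T) e ≡ true → (T' ∖ T) e ≡ true
    fewer e e∈ with ∈-∖⁻ (insert (remove g T' h) x) T e e∈
    ... | e∈T'' , Te = ∈-∖ {S = T'} {S' = T} (remove-⊆ T' h e e∈T'-h) Te
      where e∈T'-h : remove g T' h e ≡ true
            e∈T'-h = trans (sym (insert-≢ _ (∈-∉-≢ {S = T} Tx Te ∘ sym))) e∈T''

  spanning-⊆-acyclic : (∀ u v → Connected g T' u v) → Acyclic g T → T' ⊆ T → ∀ e → T e ≡ T' e
  spanning-⊆-acyclic {T' = T'} {T = T} span' acyclic T'⊆T e with T e in Te | T' e in T'e
  ... | true  | true  = refl
  ... | false | false = refl
  ... | false | true  = contradiction (trans (sym (T'⊆T e T'e)) Te) λ ()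
  ... | true  | false = contradiction (e , Te , connected-mono T'⊆T-e (span' _ _)) acyclic
    where T'⊆T-e : T' ⊆ remove g T e
          T'⊆T-e e' T'e' = trans (remove-≢ {S = T} (∈-∉-≢ {S = T'} T'e' T'e)) (T'⊆T e' T'e')

  CycleOptimal : (Edge → ℚ) → EdgeSet g → Set
  CycleOptimal w T = ∀ {x y} → T x ≡ true → T y ≡ false → Essential T x y → w x ℚ.≤ w y

  MST⇒cycleOptimal : MST g w T → CycleOptimal w T
  MST⇒cycleOptimal {w = w} (tree , minimal) {x} {y} Tx Ty essential = decidable-stable (w x ℚ.≤? w y) do
    tree' ← exchange tree Tx essential
    return (+-cancelˡ-≤ℚ (sumℚ-exchange w Tx Ty) (minimal _ tree'))

  cycleOptimal⇒MST : SpanningTree g T → CycleOptimal w T → MST g w T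
  cycleOptimal⇒MST {T = T} {w = w} tree@(_ , acyclic) optimal =
    tree , λ T' tree' → go T' tree' (⊂-wellFounded _)
    where
    go : ∀ T' → SpanningTree g T' → Acc Subset._⊂_ (tabulate (T' ∖ T)) → sumℚ T w ℚ.≤ sumℚ T' w
    go T' tree'@(span' , _) (acc smaller) with any? (λ h → (T' h Bool.≟ true) ×-dec (T h Bool.≟ false))
    ... | no T'⊈T = ℚ.≤-reflexive (begin
      sumℚ T w                               ≡⟨ sumℚ≡sum T w ⟩
      sum T w                                ≡⟨ sum-cong w (spanning-⊆-acyclic span' acyclic T'⊆T) ⟩
      sum T' w                               ≡⟨ sumℚ≡sum T' w ⟨
      sumℚ T' w                              ∎)
      where
      open ≡-Reasoning
      open MaskedSum ℚ.+-0-commutativeMonoid using (sum; sum-cong)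
      T'⊆T : T' ⊆ T
      T'⊆T e T'e with T e in Te
      ... | true  = refl
      ... | false = contradiction (e , T'e , Te) T'⊈T
    ... | yes (h , T'h , Th) = decidable-stable (_ ℚ.≤? _) do
      (x , Tx , T'x , h-essential' , x-essential) ← symmetric-exchange tree' tree T'h Th
      tree'' ← exchange tree' T'h h-essential'
      let T''≤T' = +-cancelʳ-≤ℚ (sumℚ-exchange w T'h T'x) (optimal Tx Th x-essential)
      return (ℚ.≤-trans (go _ tree'' (smaller (exchange-∖-⊂ T'h Th Tx T'x))) T''≤T')

  _<ₗₑₓ_ : Rel (ℚ × ℤ) 0ℓ
  _<ₗₑₓ_ = ×-Lex _≡_ ℚ._<_ ℤ._<_

  <ₗₑₓ⇒≤ : ∀ {a b s r} → (a , s) <ₗₑₓ (b , r) → a ℚ.≤ b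
  <ₗₑₓ⇒≤ (inj₁ a<b)     = ℚ.<⇒≤ a<b
  <ₗₑₓ⇒≤ (inj₂ (a≡b , _)) = ℚ.≤-reflexive a≡b

  uniqueMSTε⇒<ₗₑₓ : UniqueMSTε g c t T → T x ≡ true → T y ≡ false → Essential T x y →
                    (c x , t x) <ₗₑₓ (c y , t y)
  uniqueMSTε⇒<ₗₑₓ {c = c} {t = t} {T = T} {x = x} {y = y} ((tree , minimal) , unique) Tx Ty essential =
    decidable-stable (×-decidable ℚ._≟_ ℚ._<?_ ℤ._<?_ _ _) do
      tree' ← exchange tree Tx essential
      return (compare tree' (minimal T-x+y tree'))
    where
    T-x+y : EdgeSet g
    T-x+y = insert (remove g T x) y
    compare : SpanningTree g T-x+y →
              (sumℚ T c ℚ.< sumℚ T-x+y c) ⊎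
              (sumℚ T c ≡ sumℚ T-x+y c × sumℤ T t ℤ.≤ sumℤ T-x+y t) →
              (c x , t x) <ₗₑₓ (c y , t y)
    compare _ (inj₁ T<T-x+y) = inj₁ (+-cancelˡ-<ℚ (sumℚ-exchange c Tx Ty) T<T-x+y)
    compare tree' (inj₂ (T≡T-x+y , _)) with t x ℤ.<? t y
    ... | yes tx<ty = inj₂ (cx≡cy , tx<ty)
      where cx≡cy : c x ≡ c y
            cx≡cy = ℚ.≤-antisym (+-cancelˡ-≤ℚ (sumℚ-exchange c Tx Ty) (ℚ.≤-reflexive T≡T-x+y))
                                (+-cancelˡ-≤ℚ (sym (sumℚ-exchange c Tx Ty)) (ℚ.≤-reflexive (sym T≡T-x+y)))
    ... | no tx≮ty =
      contradiction (trans (sym (insert-self _ y)) (trans (unique T-x+y T-x+y-minimal y) Ty)) λ ()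
      where
      T-x+y≤T : sumℤ T-x+y t ℤ.≤ sumℤ T t
      T-x+y≤T = +-cancelʳ-≤ℤ (sumℤ-exchange t Tx Ty) (ℤ.≮⇒≥ tx≮ty)
      T-x+y-minimal : MSTε g c t T-x+y
      T-x+y-minimal = tree' , λ T' tree'' →
        Sum.map (subst (ℚ._< sumℚ T' c) T≡T-x+y)
                (Product.map (trans (sym T≡T-x+y)) (ℤ.≤-trans T-x+y≤T))
                (minimal T' tree'')

  -- Uncertainty instances

  CycleCondition⁺ : Uncertainty g → EdgeSet g → Set
  CycleCondition⁺ I T = ∀ {x h} → T x ≡ true → T h ≡ false → Essential T x h →
                        U I x ℚ.≤ ŵ I h × ŵ I x ℚ.≤ L I h

  module _ {w : Edge → ℚ} {I : Uncertainty g} (valid : Valid g w I) where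

    open-interval : ∀ {e a} → trivial I e ≡ false → InI I e a → L I e ℚ.< a × a ℚ.< U I e
    open-interval {e} {a} open-e =
      subst (λ b → if b then a ≡ L I e else (L I e ℚ.< a × a ℚ.< U I e)) open-e

    trivial-interval : ∀ {e a} → trivial I e ≡ true → InI I e a → a ≡ L I e
    trivial-interval {e} {a} trivial-e =
      subst (λ b → if b then a ≡ L I e else (L I e ℚ.< a × a ℚ.< U I e)) trivial-e

    ∈-open-interval : ∀ {e a} → trivial I e ≡ false → L I e ℚ.< a × a ℚ.< U I e → InI I e a
    ∈-open-interval {e} {a} open-e =
      subst (λ b → if b then a ≡ L I e else (L I e ℚ.< a × a ℚ.< U I e)) (sym open-e)

    prediction∈I : ∀ e → InI I e (ŵ I e)
    prediction∈I e = proj₁ (proj₂ (proj₂ (valid e)))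

    trivial⇒U≡L : trivial I e ≡ true → U I e ≡ L I e
    trivial⇒U≡L {e} = proj₂ (proj₂ (proj₂ (valid e)))

    interval-bounds : ∀ {e a} → InI I e a → L I e ℚ.≤ a × a ℚ.≤ U I e
    interval-bounds {e} a∈ with trivial I e in trivial-e
    ... | true  = ℚ.≤-reflexive (sym a∈) , ℚ.≤-reflexive (trans a∈ (sym (trivial⇒U≡L trivial-e)))
    ... | false = Product.map ℚ.<⇒≤ ℚ.<⇒≤ a∈

    open-L<U : trivial I e ≡ false → L I e ℚ.< U I e
    open-L<U {e} open-e = let (L<ŵ , ŵ<U) = open-interval open-e (prediction∈I e) in ℚ.<-trans L<ŵ ŵ<U

    L≤ŵ : L I e ℚ.≤ ŵ I e
    L≤ŵ {e} = proj₁ (interval-bounds (prediction∈I e))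

    ŵ≤U : ŵ I e ℚ.≤ U I e
    ŵ≤U {e} = proj₂ (interval-bounds (prediction∈I e))

    module _ {T : EdgeSet g} (lower : UniqueLowerLimitTree g I T) where

      lowerLimit-≤ : T x ≡ true → T y ≡ false → Essential T x y → L I x ℚ.≤ L I y
      lowerLimit-≤ Tx Ty essential = <ₗₑₓ⇒≤ (uniqueMSTε⇒<ₗₑₓ lower Tx Ty essential)

      lowerLimit-< : trivial I x ≡ false → T x ≡ true → T y ≡ false → Essential T x y →
                     L I x ℚ.< L I y
      lowerLimit-< {y = y} open-x Tx Ty essential with uniqueMSTε⇒<ₗₑₓ lower Tx Ty essential
      ... | inj₁ Lx<Ly      = Lx<Ly
      ... | inj₂ (_ , εx<εy) = ⊥-elim (ℤ.<-irrefl refl (ℤ.<-≤-trans εx<εy' (lowerEps≤1 y)))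
        where
        εx<εy' : ℤ.+ 1 ℤ.< lowerEps I y
        εx<εy' = subst (ℤ._< lowerEps I y) (cong (λ b → if b then ℤ.+ 0 else ℤ.+ 1) open-x) εx<εy
        lowerEps≤1 : ∀ e → lowerEps I e ℤ.≤ ℤ.+ 1
        lowerEps≤1 e with trivial I e
        ... | true  = ℤ.+≤+ ℕ.z≤n
        ... | false = ℤ.≤-refl

    module _ {T : EdgeSet g} (upper : UniqueUpperLimitTree g I T) where

      upperLimit-≤ : T x ≡ true → T y ≡ false → Essential T x y → U I x ℚ.≤ U I y
      upperLimit-≤ Tx Ty essential = <ₗₑₓ⇒≤ (uniqueMSTε⇒<ₗₑₓ upper Tx Ty essential)

      upperLimit-< : trivial I y ≡ false → T x ≡ true → T y ≡ false → Essential T x y →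
                     U I x ℚ.< U I y
      upperLimit-< {x = x} open-y Tx Ty essential with uniqueMSTε⇒<ₗₑₓ upper Tx Ty essential
      ... | inj₁ Ux<Uy      = Ux<Uy
      ... | inj₂ (_ , εx<εy) = ⊥-elim (ℤ.<-irrefl refl (ℤ.≤-<-trans (-1≤upperEps x) εx<εy'))
        where
        εx<εy' : upperEps I x ℤ.< ℤ.-[1+ 0 ]
        εx<εy' = subst (upperEps I x ℤ.<_) (cong (λ b → if b then ℤ.+ 0 else ℤ.-[1+ 0 ]) open-y) εx<εy
        -1≤upperEps : ∀ e → ℤ.-[1+ 0 ] ℤ.≤ upperEps I e
        -1≤upperEps e with trivial I e
        ... | true  = ℤ.-≤+
        ... | false = ℤ.≤-refl

    updated : Edge → ℚ → Edge → ℚ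
    updated e c = updateAt (ŵ I) e (λ _ → c)

    updated-self : ∀ e c → updated e c e ≡ c
    updated-self e c = updateAt-updates e (ŵ I)

    updated-other : ∀ {e h} c → h ≢ e → updated e c h ≡ ŵ I h
    updated-other {e} {h} c h≢e = updateAt-minimal h e (ŵ I) h≢e

    feasible-tree-MST : ∀ {Q e c} → ((T₀ , _) : Feasible g I (ŵ I) Q) → Q e ≡ false →
                        trivial I e ≡ false → L I e ℚ.< c × c ℚ.< U I e → MST g (updated e c) T₀
    feasible-tree-MST {Q} {e} {c} (T₀ , feasible) Qe open-e c∈ = feasible (updated e c) agrees-on-Q in-intervals
      where
      agrees-on-Q : ∀ h → Q h ≡ true → updated e c h ≡ ŵ I h
      agrees-on-Q h Qh = updated-other c λ { refl → contradiction (trans (sym Qh) Qe) λ () }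
      in-intervals : ∀ h → Q h ≡ false → InI I h (updated e c h)
      in-intervals h _ with h ≟ e
      ... | yes refl = subst (InI I e) (sym (updated-self e c)) (∈-open-interval open-e c∈)
      ... | no h≢e   = subst (InI I h) (sym (updated-other c h≢e)) (prediction∈I h)

    mandatory-if-membership-flips : ∀ {e a b} → trivial I e ≡ false →
      L I e ℚ.< a × a ℚ.< U I e → L I e ℚ.< b × b ℚ.< U I e →
      (∀ {T'} → MST g (updated e a) T' → T' e ≡ false → ⊥) →
      (∀ {T'} → MST g (updated e b) T' → T' e ≡ true → ⊥) →
      PredictionMandatory g I e
    mandatory-if-membership-flips {e} open-e a∈ b∈ a-forces b-forbids Q feasible@(T₀ , _) with Q e in Qe
    ... | true = refl
    ... | false with T₀ e in T₀e
    ...   | true  = ⊥-elim (b-forbids (feasible-tree-MST feasible Qe open-e b∈) T₀e)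
    ...   | false = ⊥-elim (a-forces (feasible-tree-MST feasible Qe open-e a∈) T₀e)

    mandatory-by-exchange : trivial I e ≡ false →
      (∀ {T'} → SpanningTree g T' → T' e ≡ false →
         ¬ ¬ ∃ λ h → T' h ≡ true × Essential T' h e × L I e ℚ.< ŵ I h) →
      (∀ {T'} → SpanningTree g T' → T' e ≡ true →
         ¬ ¬ ∃ λ h → T' h ≡ false × Essential T' e h × ŵ I h ℚ.< U I e) →
      PredictionMandatory g I e
    mandatory-by-exchange {e} open-e cycle-witness cut-witness
      with ∃-between-below-allℚ (open-L<U open-e) (ŵ I) | ∃-between-above-allℚ (open-L<U open-e) (ŵ I)
    ... | a , L<a , a<U , a-below | b , L<b , b<U , b-above =
      mandatory-if-membership-flips open-e (L<a , a<U) (L<b , b<U) a-forces b-forbids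
      where
      a-forces : ∀ {T'} → MST g (updated e a) T' → T' e ≡ false → ⊥
      a-forces {T'} mst T'e = ¬¬⊥⇒⊥ do
        (h , T'h , essential , L<ŵh) ← cycle-witness (proj₁ mst) T'e
        let h≤e = MST⇒cycleOptimal mst T'h T'e essential
        return (ℚ.<-irrefl refl (ℚ.<-≤-trans (a-below h L<ŵh)
                  (subst₂ ℚ._≤_ (updated-other a (∈-∉-≢ {S = T'} T'h T'e)) (updated-self e a) h≤e)))

      b-forbids : ∀ {T'} → MST g (updated e b) T' → T' e ≡ true → ⊥
      b-forbids {T'} mst T'e = ¬¬⊥⇒⊥ do
        (h , T'h , essential , ŵh<U) ← cut-witness (proj₁ mst) T'e
        let e≤h = MST⇒cycleOptimal mst T'e T'h essential
        return (ℚ.<-irrefl refl (ℚ.≤-<-trans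
                  (subst₂ ℚ._≤_ (updated-self e b) (updated-other b (∈-∉-≢ {S = T'} T'e T'h ∘ sym))
                                e≤h)
                  (b-above h ŵh<U)))

    module _ {T : EdgeSet g} (upper : UniqueUpperLimitTree g I T) where
      open ℚ.≤-Reasoning

      cycleCondition⇒cycleCondition⁺ : CycleCondition g I T → CycleCondition⁺ I T
      cycleCondition⇒cycleCondition⁺ cc {x} {h} Tx Th essential with trivial I h in trivial-h
      ... | false = cc h trivial-h Th x (essential⇒inCycle (proj₁ (proj₁ (proj₁ upper))) essential)
      ... | true  =
        (begin U I x ≤⟨ Ux≤Uh ⟩ U I h ≡⟨ trivial⇒U≡L trivial-h ⟩ L I h ≡⟨ ŵ≡L ⟨ ŵ I h ∎) ,
        (begin ŵ I x ≤⟨ ŵ≤U ⟩ U I x ≤⟨ Ux≤Uh ⟩ U I h ≡⟨ trivial⇒U≡L trivial-h ⟩ L I h ∎)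
        where Ux≤Uh : U I x ℚ.≤ U I h
              Ux≤Uh = upperLimit-≤ upper Tx Th essential
              ŵ≡L : ŵ I h ≡ L I h
              ŵ≡L = trivial-interval trivial-h (prediction∈I h)

      cycleCondition⁺⇒mandatoryFree : CycleCondition⁺ I T → PredictionMandatoryFree g I
      cycleCondition⁺⇒mandatoryFree cc⁺ e mandatory =
        contradiction (trans (sym (mandatory all-but-e (T , certified))) (remove-self _ e)) λ ()
        where
        all-but-e : EdgeSet g
        all-but-e = remove g (λ _ → true) e
        certified : ∀ w' → (∀ h → all-but-e h ≡ true → w' h ≡ ŵ I h) →
                    (∀ h → all-but-e h ≡ false → InI I h (w' h)) → MST g w' T
        certified w' agrees in-interval = cycleOptimal⇒MST (proj₁ (proj₁ upper)) optimal
          where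
          agrees' : ∀ {h} → h ≢ e → w' h ≡ ŵ I h
          agrees' h≢e = agrees _ (remove-≢ h≢e)
          e-bounds : L I e ℚ.≤ w' e × w' e ℚ.≤ U I e
          e-bounds = interval-bounds (in-interval e (remove-self _ e))
          L≤w' : ∀ h → L I h ℚ.≤ w' h
          L≤w' h with h ≟ e
          ... | yes refl = proj₁ e-bounds
          ... | no h≢e   = subst (L I h ℚ.≤_) (sym (agrees' h≢e)) L≤ŵ
          optimal : CycleOptimal w' T
          optimal {x} {h} Tx Th essential with x ≟ e
          ... | yes refl = begin w' x ≤⟨ proj₂ e-bounds ⟩ U I x ≤⟨ proj₁ (cc⁺ Tx Th essential) ⟩
                                 ŵ I h ≡⟨ agrees' (∈-∉-≢ {S = T} Tx Th ∘ sym) ⟨ w' h ∎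
          ... | no x≢e   = begin w' x ≡⟨ agrees' x≢e ⟩ ŵ I x ≤⟨ proj₂ (cc⁺ Tx Th essential) ⟩
                                 L I h ≤⟨ L≤w' h ⟩ w' h ∎

      cycleCondition⇒mandatoryFree : CycleCondition g I T → PredictionMandatoryFree g I
      cycleCondition⇒mandatoryFree = cycleCondition⁺⇒mandatoryFree ∘ cycleCondition⇒cycleCondition⁺

    module _ {T : EdgeSet g} (lower : UniqueLowerLimitTree g I T) (upper : UniqueUpperLimitTree g I T) where
      open ℚ.≤-Reasoning

      private
        tree : SpanningTree g T
        tree = proj₁ (proj₁ lower)

      max-upper-on-cycle-mandatory : trivial I f ≡ false → T f ≡ false →
        Walk g T (src g f) (tgt g f) es vs → Unique vs → x ∈ es →
        (∀ {k} → k ∈ es → U I k ℚ.≤ U I x) → ŵ I f ℚ.< U I x → PredictionMandatory g I x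
      max-upper-on-cycle-mandatory {f} {es = es} {x = x} open-f Tf walk unique x∈ maximal ŵf<Ux =
        mandatory-by-exchange open-x cycle-witness cut-witness
        where
        Tx : T x ≡ true
        Tx = walk-edge walk x∈
        on-cycle : ∀ {k} → k ∈ es → Essential T k f
        on-cycle = path-edge-disconnects (proj₂ tree) walk unique
        Lf<ŵf : L I f ℚ.< ŵ I f
        Lf<ŵf = proj₁ (open-interval open-f (prediction∈I f))

        open-x : trivial I x ≡ false
        open-x with trivial I x in trivial-x
        ... | false = refl
        ... | true  = ⊥-elim (ℚ.<-irrefl refl (begin-strict
              U I x ≡⟨ trivial⇒U≡L trivial-x ⟩ L I x ≤⟨ lowerLimit-≤ lower Tx Tf (on-cycle x∈) ⟩
              L I f <⟨ Lf<ŵf ⟩ ŵ I f <⟨ ŵf<Ux ⟩ U I x ∎))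

        ŵ<Ux : ∀ {k} → k ∈ es → ŵ I k ℚ.< U I x
        ŵ<Ux {k} k∈ with trivial I k in trivial-k
        ... | true  = begin-strict ŵ I k ≡⟨ trivial-interval trivial-k (prediction∈I k) ⟩
                        L I k ≤⟨ lowerLimit-≤ lower (walk-edge walk k∈) Tf (on-cycle k∈) ⟩
                        L I f <⟨ Lf<ŵf ⟩ ŵ I f <⟨ ŵf<Ux ⟩ U I x ∎
        ... | false = ℚ.<-≤-trans (proj₂ (open-interval trivial-k (prediction∈I k))) (maximal k∈)

        cycle-witness : ∀ {T'} → SpanningTree g T' → T' x ≡ false →
                        ¬ ¬ ∃ λ h → T' h ≡ true × Essential T' h x × L I x ℚ.< ŵ I h
        cycle-witness tree' T'x = do
          (h , T'h , Th , x-essential , h-essential') ← symmetric-exchange tree tree' Tx T'x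
          return (h , T'h , h-essential' , ℚ.<-≤-trans (lowerLimit-< lower open-x Tx Th x-essential) L≤ŵ)

        cut-witness : ∀ {T'} → SpanningTree g T' → T' x ≡ true →
                      ¬ ¬ ∃ λ h → T' h ≡ false × Essential T' x h × ŵ I h ℚ.< U I x
        cut-witness (_ , acyclic') T'x = do
          no f-cut ← ¬¬-excluded-middle
            where yes f-joined → do
                    (h , h∈ , h≢x , x-essential') ←
                      path-second-crossing walk unique x∈ (λ joins → acyclic' (x , T'x , joins)) f-joined
                    return (h , essential⇒∉ x-essential' h≢x , x-essential' , ŵ<Ux h∈)
          return (f , essential⇒∉ f-cut (∈-∉-≢ {S = T} Tx Tf ∘ sym) , f-cut , ŵf<Ux)

      mandatoryFree⇒U≤ŵ : PredictionMandatoryFree g I → trivial I f ≡ false → T f ≡ false →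
                          InCycleMinus g T f x → U I x ℚ.≤ ŵ I f
      mandatoryFree⇒U≤ŵ free open-f Tf (es , (_ , walk , unique) , x∈) =
        ℚ.≮⇒≥ λ ŵf<Ux → ¬¬⊥⇒⊥ do
        (x* , x*∈ , _ , maximal) ←
          ¬¬-minimal {R = λ a b → U I b ℚ.≤ U I a} (λ a b → ℚ.≤-total (U I b) (U I a))
                     (flip ℚ.≤-trans) (λ _ → ⊤) es (lose x∈ tt)
        return (free x* (max-upper-on-cycle-mandatory open-f Tf walk unique x*∈ (λ k∈ → maximal k∈ tt)
                                                      (ℚ.<-≤-trans ŵf<Ux (maximal x∈ tt))))

      Violation : Edge → Set
      Violation f = trivial I f ≡ false × T f ≡ false × ∃ λ x → Essential T x f × L I f ℚ.< ŵ I x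

      min-violation-mandatory : Violation f → (∀ {h} → Violation h → L I f ℚ.≤ L I h) →
                                PredictionMandatory g I f
      min-violation-mandatory {f} (open-f , Tf , x , x-essential , Lf<ŵx) minimal =
        mandatory-by-exchange open-f cycle-witness cut-witness
        where
        Tx : T x ≡ true
        Tx = essential⇒∈ (proj₁ tree _ _) x-essential

        cut-crossing-large : ∀ {h} → Essential T x h → L I f ℚ.< ŵ I h
        cut-crossing-large {h} x-essential-h with h ≟ x
        ... | yes refl = Lf<ŵx
        ... | no h≢x   = ℚ.≰⇒> (ŵh≰Lf (essential⇒∉ x-essential-h h≢x))
          where
          ŵh≰Lf : T h ≡ false → ¬ ŵ I h ℚ.≤ L I f
          ŵh≰Lf Th ŵh≤Lf with trivial I h in trivial-h
          ... | true  = ℚ.<-irrefl refl (begin-strict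
                U I x ≤⟨ upperLimit-≤ upper Tx Th x-essential-h ⟩ U I h ≡⟨ trivial⇒U≡L trivial-h ⟩
                L I h ≡⟨ trivial-interval trivial-h (prediction∈I h) ⟨ ŵ I h ≤⟨ ŵh≤Lf ⟩
                L I f <⟨ Lf<ŵx ⟩ ŵ I x ≤⟨ ŵ≤U ⟩ U I x ∎)
          ... | false = ℚ.<-irrefl refl (begin-strict
                L I f ≤⟨ minimal (trivial-h , Th , x , x-essential-h ,
                                  ℚ.<-trans Lh<ŵh (ℚ.≤-<-trans ŵh≤Lf Lf<ŵx)) ⟩
                L I h <⟨ Lh<ŵh ⟩ ŵ I h ≤⟨ ŵh≤Lf ⟩ L I f ∎)
            where Lh<ŵh : L I h ℚ.< ŵ I h
                  Lh<ŵh = proj₁ (open-interval trivial-h (prediction∈I h))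

        cycle-witness : ∀ {T'} → SpanningTree g T' → T' f ≡ false →
                        ¬ ¬ ∃ λ h → T' h ≡ true × Essential T' h f × L I f ℚ.< ŵ I h
        cycle-witness tree' T'f = do
          (h , T'h , h-essential' , x-essential-h) ← cycle-crossing tree' x-essential
          return (h , T'h , h-essential' , cut-crossing-large x-essential-h)

        cut-witness : ∀ {T'} → SpanningTree g T' → T' f ≡ true →
                      ¬ ¬ ∃ λ h → T' h ≡ false × Essential T' f h × ŵ I h ℚ.< U I f
        cut-witness (_ , acyclic') T'f = do
          (h , Th , h-essential , f-essential') ← cycle-crossing tree λ joins → acyclic' (f , T'f , joins)
          return (h , essential⇒∉ f-essential' (∈-∉-≢ {S = T} Th Tf) , f-essential' ,
                  ℚ.≤-<-trans ŵ≤U (upperLimit-< upper open-f Th Tf h-essential))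

      mandatoryFree⇒ŵ≤L : PredictionMandatoryFree g I → trivial I f ≡ false → T f ≡ false →
                          InCycleMinus g T f x → ŵ I x ℚ.≤ L I f
      mandatoryFree⇒ŵ≤L {f} {x} free open-f Tf x∈cycle = ℚ.≮⇒≥ λ Lf<ŵx → ¬¬⊥⇒⊥ do
        let f-violates = open-f , Tf , x , inCycle⇒essential (proj₂ tree) x∈cycle , Lf<ŵx
        (f* , _ , f*-violates , minimal) ←
          ¬¬-minimal {R = λ a b → L I a ℚ.≤ L I b} (λ a b → ℚ.≤-total (L I a) (L I b)) ℚ.≤-trans
                     Violation (allFin _) (lose (∈-allFin f) f-violates)
        return (free f* (min-violation-mandatory f*-violates (minimal (∈-allFin _))))

      mandatoryFree⇒cycleCondition : PredictionMandatoryFree g I → CycleCondition g I T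
      mandatoryFree⇒cycleCondition free f open-f Tf x x∈cycle =
        mandatoryFree⇒U≤ŵ free open-f Tf x∈cycle , mandatoryFree⇒ŵ≤L free open-f Tf x∈cycle

  -- Querying

  module _ {w : Edge → ℚ} {I : Uncertainty g} (valid : Valid g w I) (Q : EdgeSet g) where

    query-valid : Valid g w (query g w Q I)
    query-valid e with Q e
    ... | true  = proj₁ (valid e) , refl , refl , λ _ → refl
    ... | false = valid e

    query-L≥ : L I e ℚ.≤ L (query g w Q I) e
    query-L≥ {e} with Q e
    ... | true  = proj₁ (interval-bounds valid (proj₁ (proj₂ (valid e))))
    ... | false = ℚ.≤-refl

    query-U≤ : U (query g w Q I) e ℚ.≤ U I e
    query-U≤ {e} with Q e
    ... | true  = proj₂ (interval-bounds valid (proj₁ (proj₂ (valid e))))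
    ... | false = ℚ.≤-refl

    unqueried : trivial (query g w Q I) e ≡ false → Q e ≡ false
    unqueried {e} = ∨-conicalˡ (Q e) (trivial I e)

    unqueried-open : trivial (query g w Q I) e ≡ false → trivial I e ≡ false
    unqueried-open {e} = ∨-conicalʳ (Q e) (trivial I e)

    unqueried-L : trivial (query g w Q I) e ≡ false → L (query g w Q I) e ≡ L I e
    unqueried-L open' rewrite unqueried open' = refl

    unqueried-U : trivial (query g w Q I) e ≡ false → U (query g w Q I) e ≡ U I e
    unqueried-U open' rewrite unqueried open' = refl

    unqueried-ŵ : trivial (query g w Q I) e ≡ false → ŵ (query g w Q I) e ≡ ŵ I e
    unqueried-ŵ open' rewrite unqueried open' = refl

  module _ {w : Edge → ℚ} {I : Uncertainty g} (valid : Valid g w I)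
           {T : EdgeSet g} (upper : UniqueUpperLimitTree g I T) (cc⁺ : CycleCondition⁺ I T) (Q : EdgeSet g)
           {T' : EdgeSet g} (lower' : UniqueLowerLimitTree g (query g w Q I) T')
                            (upper' : UniqueUpperLimitTree g (query g w Q I) T') where
    open ℚ.≤-Reasoning

    private
      I' : Uncertainty g
      I' = query g w Q I
      valid' : Valid g w I'
      valid' = query-valid valid Q
      tree : SpanningTree g T
      tree = proj₁ (proj₁ upper)
      tree' : SpanningTree g T'
      tree' = proj₁ (proj₁ lower')

    open-outside-stays-outside : trivial I' f ≡ false → T' f ≡ false → T f ≡ false
    open-outside-stays-outside {f} open'-f T'f with T f in Tf
    ... | false = refl
    ... | true  = ⊥-elim (¬¬⊥⇒⊥ do
      (z , T'z , Tz , f-essential , z-essential') ← symmetric-exchange tree tree' Tf T'f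
      return (ℚ.<-irrefl refl (begin-strict
        ŵ I f   ≤⟨ proj₂ (cc⁺ Tf Tz f-essential) ⟩
        L I z   ≤⟨ query-L≥ valid Q ⟩
        L I' z  ≤⟨ lowerLimit-≤ valid' lower' T'z T'f z-essential' ⟩
        L I' f  ≡⟨ unqueried-L valid Q open'-f ⟩
        L I f   <⟨ proj₁ (open-interval valid (unqueried-open valid Q open'-f) (prediction∈I valid f)) ⟩
        ŵ I f   ∎)))

    upper-below-prediction : trivial I' f ≡ false → T' f ≡ false → T' x ≡ true → Essential T' x f →
                             U I' x ℚ.≤ ŵ I f
    upper-below-prediction {f} {x} open'-f T'f T'x x-essential' = decidable-stable (_ ℚ.≤? _) do
      (h , Th , h-essential , x-essential'-h) ← cycle-crossing tree x-essential'
      return (begin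
        U I' x  ≤⟨ U'x≤U'h x-essential'-h ⟩
        U I' h  ≤⟨ query-U≤ valid Q ⟩
        U I h   ≤⟨ proj₁ (cc⁺ Th (open-outside-stays-outside open'-f T'f) h-essential) ⟩
        ŵ I f   ∎)
      where
      U'x≤U'h : ∀ {h} → Essential T' x h → U I' x ℚ.≤ U I' h
      U'x≤U'h {h} x-essential'-h with h ≟ x
      ... | yes refl = ℚ.≤-refl
      ... | no h≢x   = upperLimit-≤ valid' upper' T'x (essential⇒∉ x-essential'-h h≢x) x-essential'-h

    prediction-below-lower : trivial I' f ≡ false → T' f ≡ false → InCycleMinus g T' f x →
                             trivial I' x ≡ false → ŵ I x ℚ.≤ L I f
    prediction-below-lower {f} {x} open'-f T'f (_ , (_ , walk' , unique') , x∈) open'-x with T x in Tx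
    ... | false = ⊥-elim (¬¬⊥⇒⊥ do
      (y , Ty , T'y , x-essential' , y-essential) ← symmetric-exchange tree' tree T'x Tx
      return (ℚ.<-irrefl refl (begin-strict
        U I x   ≡⟨ unqueried-U valid Q open'-x ⟨
        U I' x  ≤⟨ upperLimit-≤ valid' upper' T'x T'y x-essential' ⟩
        U I' y  ≤⟨ query-U≤ valid Q ⟩
        U I y   ≤⟨ proj₁ (cc⁺ Ty Tx y-essential) ⟩
        ŵ I x   <⟨ proj₂ (open-interval valid (unqueried-open valid Q open'-x) (prediction∈I valid x)) ⟩
        U I x   ∎)))
      where T'x : T' x ≡ true
            T'x = walk-edge walk' x∈
    ... | true = decidable-stable (_ ℚ.≤? _) do
      yes f-joined ← ¬¬-excluded-middle
        where no x-essential → return (proj₂ (cc⁺ Tx Tf x-essential))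
      (h , h∈ , h≢x , x-essential-h) ←
        path-second-crossing walk' unique' x∈ (λ joins → proj₂ tree (x , Tx , joins)) f-joined
      return (begin
        ŵ I x   ≤⟨ proj₂ (cc⁺ Tx (essential⇒∉ x-essential-h h≢x) x-essential-h) ⟩
        L I h   ≤⟨ query-L≥ valid Q ⟩
        L I' h  ≤⟨ lowerLimit-≤ valid' lower' (walk-edge walk' h∈) T'f
                                (path-edge-disconnects (proj₂ tree') walk' unique' h∈) ⟩
        L I' f  ≡⟨ unqueried-L valid Q open'-f ⟩
        L I f   ∎)
      where Tf : T f ≡ false
            Tf = open-outside-stays-outside open'-f T'f

    query-cycleCondition : CycleCondition g I' T'
    query-cycleCondition f open'-f T'f x x∈cycle' = U'x≤ŵ'f , ŵ'x≤L'f
      where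
      T'x : T' x ≡ true
      T'x = inCycle⇒∈ x∈cycle'
      x-essential' : Essential T' x f
      x-essential' = inCycle⇒essential (proj₂ tree') x∈cycle'
      U'x≤ŵ'f : U I' x ℚ.≤ ŵ I' f
      U'x≤ŵ'f = begin
        U I' x  ≤⟨ upper-below-prediction open'-f T'f T'x x-essential' ⟩
        ŵ I f   ≡⟨ unqueried-ŵ valid Q open'-f ⟨
        ŵ I' f  ∎
      ŵ'x≤L'f : ŵ I' x ℚ.≤ L I' f
      ŵ'x≤L'f with trivial I' x in trivial'-x
      ... | true  = begin
        ŵ I' x  ≡⟨ trivial-interval valid' trivial'-x (prediction∈I valid' x) ⟩
        L I' x  ≤⟨ lowerLimit-≤ valid' lower' T'x T'f x-essential' ⟩
        L I' f  ∎
      ... | false = begin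
        ŵ I' x  ≡⟨ unqueried-ŵ valid Q trivial'-x ⟩
        ŵ I x   ≤⟨ prediction-below-lower open'-f T'f x∈cycle' trivial'-x ⟩
        L I f   ≡⟨ unqueried-L valid Q open'-f ⟨
        L I' f  ∎

lemma3p5 : (g : Graph) → GraphConnected g →
    (w : Fin (m g) → ℚ) → (I : Uncertainty g) → Valid g w I →
    (TL : EdgeSet g) → UniqueLowerLimitTree g I TL → UniqueUpperLimitTree g I TL →
    (PredictionMandatoryFree g I ⇔ CycleCondition g I TL)
    × (PredictionMandatoryFree g I →
        ∀ (Q : EdgeSet g) (TL' : EdgeSet g) →
        UniqueLowerLimitTree g (query g w Q I) TL' →
        UniqueUpperLimitTree g (query g w Q I) TL' →
        PredictionMandatoryFree g (query g w Q I))
lemma3p5 g _ w I valid TL lower upper =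
  mk⇔ (mandatoryFree⇒cycleCondition g valid lower upper) (cycleCondition⇒mandatoryFree g valid upper) ,
  λ free Q TL' lower' upper' →
    let cc = mandatoryFree⇒cycleCondition g valid lower upper free
        cc⁺ = cycleCondition⇒cycleCondition⁺ g valid upper cc
    in cycleCondition⇒mandatoryFree g (query-valid g valid Q) upper'
         (query-cycleCondition g valid upper cc⁺ Q lower' upper')
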